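{- Let $p$ be any one of the patterns $10$, $001$, $010$, $011$. Then for every $n\ge 1$, the number of ascent sequences of length $n$ that avoid $p$ is $2^{n-1}$. Moreover, for every $k\ge 0$, the number of ascent sequences of length $n$ avoiding $p$ and having exactly $k$ ascents is $\binom{n-1}{k}$.
   Context: An ascent sequence is a finite sequence $x_1x_2\ldots x_n$ of nonnegative integers with $x_1=0$ and $x_i\le \operatorname{asc}(x_1\ldots x_{i-1})+1$ for all $1<i\le n$, where $\operatorname{asc}(y_1\ldots y_k)$, the number of ascents, is the number of indices $j$ with $y_j<y_{j+1}$. A pattern is a finite word over the nonnegative integers (repetitions allowed). An occurrence of a pattern $p=p_1\ldots p_k$ in a sequence $x_1\ldots x_n$ is a subsequence $x_{i_1}\ldots x_{i_k}$ with $i_1<\cdots<i_k$ such that for all $a,b$: $x_{i_a}<x_{i_b}$ iff $p_a<p_b$, and $x_{i_a}=x_{i_b}$ iff $p_a=p_b$. A sequence avoids $p$ if it has no occurrence of $p$. -}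

module Defs where

open import Data.Nat using (ℕ; zero; suc; _<_; _≤_; _+_; _<ᵇ_)
open import Data.Bool using (if_then_else_)
open import Data.List using (List; []; _∷_; length; lookup)
open import Data.List.Relation.Binary.Sublist.Propositional using (_⊆_)
open import Data.List.Relation.Unary.Unique.Propositional using (Unique)
open import Data.List.Membership.Propositional using (_∈_)
open import Data.Fin using (Fin; cast)
open import Data.Product using (Σ; ∃; _×_)
open import Relation.Nullary using (¬_)
open import Relation.Binary.PropositionalEquality using (_≡_)
open import Function.Bundles using (_⇔_)

ascFrom : ℕ → List ℕ → ℕ
ascFrom x [] = 0
ascFrom x (y ∷ ys) = (if x <ᵇ y then 1 else 0) + ascFrom y ys

asc : List ℕ → ℕ
asc [] = 0
asc (x ∷ xs) = ascFrom x xs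

-- IsAscentSeq xs : x₁ = 0 and x_i ≤ asc(x₁…x_{i-1}) + 1 for 1 < i ≤ n.
open import Data.List using (_++_; [_])

data IsAscentSeq : List ℕ → Set where
  empty : IsAscentSeq []
  single : IsAscentSeq (0 ∷ [])
  snoc : ∀ {ys} x → IsAscentSeq ys → ¬ (ys ≡ []) → x ≤ asc ys + 1 →
         IsAscentSeq (ys ++ [ x ])

OrderIso : List ℕ → List ℕ → Set
OrderIso q p = Σ (length q ≡ length p) λ eq →
  ∀ (a b : Fin (length q)) →
    ((lookup q a < lookup q b) ⇔ (lookup p (cast eq a) < lookup p (cast eq b)))
    × ((lookup q a ≡ lookup q b) ⇔ (lookup p (cast eq a) ≡ lookup p (cast eq b)))

Contains : List ℕ → List ℕ → Set
Contains x p = ∃ λ q → (q ⊆ x) × OrderIso q p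

Avoids : List ℕ → List ℕ → Set
Avoids x p = ¬ Contains x p

HasCard : (List ℕ → Set) → ℕ → Set
HasCard P m = ∃ λ (xs : List (List ℕ)) →
  Unique xs × (∀ s → (s ∈ xs) ⇔ P s) × (length xs ≡ m)

module Submission where

-- For each such pattern p we exhibit a growth rule (record Growth): two maps
-- flat and rise on avoiders of length n + 1, injective with disjoint images that together
-- cover all avoiders of length n + 2, where flat keeps the number of ascents and rise adds
-- one.  Module Counting turns any growth rule into the recurrences a(n+1) = 2·a(n) and
-- c(n+1, k) = c(n, k) + c(n, k-1) with a(0) = c(0, 0) = 1, which gives both counts.
--   • 10, 010 and 011 (module SnocFamily): every avoider t x arises from the avoider t by
--     appending either σ t (flat) or asc t + 1 (rise), where σ t = asc t for 10 and 010 and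
--     σ t = 0 for 011.
--   • 001: the avoiders are the staircases 0 1 … k followed by a weakly decreasing sequence
--     of entries ≤ k; flat inserts another k after the staircase, rise extends it by k + 1.
-- The file first collects facts about finite cardinalities, last entries and ascents,
-- subsequences and occurrences of 0/1-patterns, then builds the four growth rules, and
-- derives the theorem at the end.

open import Defs
open import Data.Nat using (ℕ; zero; suc; _+_; _^_; _<_; _≤_; _<ᵇ_; z≤n; s≤s)
open import Data.Nat.Properties
open import Data.Nat.Combinatorics using (_C_; nCk+nC[k+1]≡[n+1]C[k+1])
open import Data.Bool using (if_then_else_)
open import Data.Fin as Fin using (Fin; cast)
open import Data.List using (List; []; _∷_; length; map; lookup; _++_; [_]; drop)
open import Data.List.Properties
  using (length-map; length-++; ++-assoc; ++-identityʳ; ++-cancelˡ; ∷-injectiveʳ; ∷ʳ-injective)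
open import Data.List.Membership.Propositional using (_∈_)
open import Data.List.Membership.Propositional.Properties
  using (∈-map⁺; ∈-map⁻; ∈-++⁺ˡ; ∈-++⁺ʳ; ∈-++⁻; ∈-lookup)
open import Data.List.Relation.Unary.Any using (here; there)
open import Data.List.Relation.Unary.All as All using (All; []; _∷_)
open import Data.List.Relation.Unary.AllPairs using ([]; _∷_)
open import Data.List.Relation.Unary.Unique.Propositional using (Unique)
import Data.List.Relation.Unary.Unique.Propositional.Properties as Unique
open import Data.List.Relation.Binary.Sublist.Propositional
  using (_⊆_; []; _∷_; _∷ʳ_; ⊆-refl; ⊆-trans; minimum; from∈; to∈)
open import Data.List.Relation.Binary.Sublist.Propositional.Properties
  using (length-mono-≤; ++⁺; ++⁺ʳ; ∷ˡ⁻)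
open import Data.Product using (∃; ∃₂; _×_; _,_; proj₁; proj₂)
open import Data.Sum using (_⊎_; inj₁; inj₂)
import Data.Sum as Sum
open import Data.Unit using (⊤; tt)
open import Data.Empty using (⊥-elim)
open import Relation.Nullary using (¬_; yes; no)
open import Relation.Binary.PropositionalEquality
  using (_≡_; _≢_; refl; sym; trans; cong; cong₂; subst; module ≡-Reasoning)
open import Function.Bundles using (_⇔_; mk⇔; Equivalence)
import Function.Properties.Equivalence as ⇔

open Equivalence using (to; from)

Pred : Set₁
Pred = List ℕ → Set

Image : (List ℕ → List ℕ) → Pred → Pred
Image f A s = ∃ λ t → A t × s ≡ f t

InjectiveOn : Pred → (List ℕ → List ℕ) → Set
InjectiveOn A f = ∀ {s t} → A s → A t → f s ≡ f t → s ≡ t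

card-resp : ∀ {A B : Pred} {m} → (∀ s → A s ⇔ B s) → HasCard A m → HasCard B m
card-resp A⇔B (xs , unique , mem , len) = xs , unique , (λ s → ⇔.trans (mem s) (A⇔B s)) , len

card-empty : ∀ {A : Pred} → (∀ s → ¬ A s) → HasCard A 0
card-empty ¬A = [] , [] , (λ s → mk⇔ (λ ()) (λ a → ⊥-elim (¬A s a))) , refl

card-single : ∀ {A : Pred} x → (∀ s → A s ⇔ s ≡ x) → HasCard A 1
card-single x A⇔x = x ∷ [] , [] ∷ [] ,
  (λ s → ⇔.trans (mk⇔ (λ { (here e) → e ; (there ()) }) here) (⇔.sym (A⇔x s))) , refl

map-unique : ∀ {A : Pred} {f} → InjectiveOn A f → ∀ {xs} → All A xs → Unique xs → Unique (map f xs)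
map-unique {A} {f} inj [] [] = []
map-unique {A} {f} inj {x ∷ xs} (ax ∷ axs) (x∉xs ∷ unique) = fresh axs x∉xs ∷ map-unique inj axs unique
  where
  fresh : ∀ {ys} → All A ys → All (x ≢_) ys → All (f x ≢_) (map f ys)
  fresh [] [] = []
  fresh (ay ∷ ays) (x≢y ∷ x≢ys) = (λ fx≡fy → x≢y (inj ax ay fx≡fy)) ∷ fresh ays x≢ys

card-image : ∀ {A : Pred} {f m} → InjectiveOn A f → HasCard A m → HasCard (Image f A) m
card-image {A} {f} inj (xs , unique , mem , len) =
  map f xs ,
  map-unique inj (All.tabulate (λ {s} s∈xs → to (mem s) s∈xs)) unique ,
  (λ s → mk⇔ (λ s∈ → let (t , t∈xs , s≡ft) = ∈-map⁻ f s∈ in t , to (mem t) t∈xs , s≡ft)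
             (λ { (t , at , refl) → ∈-map⁺ f (from (mem t) at) })) ,
  trans (length-map f xs) len

card-union : ∀ {A B : Pred} {a b} → (∀ {s t} → A s → B t → s ≢ t) →
  HasCard A a → HasCard B b → HasCard (λ s → A s ⊎ B s) (a + b)
card-union disjoint (xs , uxs , memA , lenA) (ys , uys , memB , lenB) =
  xs ++ ys ,
  Unique.++⁺ uxs uys (λ { (s∈xs , s∈ys) → disjoint (to (memA _) s∈xs) (to (memB _) s∈ys) refl }) ,
  (λ s → mk⇔ (λ s∈ → Sum.map (to (memA s)) (to (memB s)) (∈-++⁻ xs s∈))
             (Sum.[ (λ a → ∈-++⁺ˡ (from (memA s) a)) , (λ b → ∈-++⁺ʳ xs (from (memB s) b)) ])) ,
  trans (length-++ xs) (cong₂ _+_ lenA lenB)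

lastOr : ℕ → List ℕ → ℕ
lastOr a [] = a
lastOr a (y ∷ ys) = lastOr y ys

lastEntry : List ℕ → ℕ
lastEntry [] = 0
lastEntry (y ∷ ys) = lastOr y ys

lastOr-++ : ∀ a xs ys → lastOr a (xs ++ ys) ≡ lastOr (lastOr a xs) ys
lastOr-++ a [] ys = refl
lastOr-++ a (y ∷ xs) ys = lastOr-++ y xs ys

lastEntry-snoc : ∀ t x → lastEntry (t ++ [ x ]) ≡ x
lastEntry-snoc [] x = refl
lastEntry-snoc (y ∷ ys) x = lastOr-++ y ys [ x ]

lastOr-∈ : ∀ a xs → lastOr a xs ∈ a ∷ xs
lastOr-∈ a [] = here refl
lastOr-∈ a (y ∷ xs) = there (lastOr-∈ y xs)

lastEntry-∈ : ∀ {t} → t ≢ [] → lastEntry t ∈ t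
lastEntry-∈ {[]} t≢[] = ⊥-elim (t≢[] refl)
lastEntry-∈ {y ∷ ys} _ = lastOr-∈ y ys

length-snoc : ∀ (t : List ℕ) x → length (t ++ [ x ]) ≡ suc (length t)
length-snoc [] x = refl
length-snoc (y ∷ t) x = cong suc (length-snoc t x)

snoc≢[] : ∀ (t : List ℕ) x → t ++ [ x ] ≢ []
snoc≢[] [] x ()
snoc≢[] (y ∷ t) x ()

ascFrom-++ : ∀ a xs ys → ascFrom a (xs ++ ys) ≡ ascFrom a xs + ascFrom (lastOr a xs) ys
ascFrom-++ a [] ys = refl
ascFrom-++ a (y ∷ xs) ys =
  trans (cong (step +_) (ascFrom-++ y xs ys)) (sym (+-assoc step _ _))
  where
  step : ℕ
  step = if a <ᵇ y then 1 else 0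

asc-++ : ∀ {s} t → s ≢ [] → asc (s ++ t) ≡ asc s + ascFrom (lastEntry s) t
asc-++ {[]} t s≢[] = ⊥-elim (s≢[] refl)
asc-++ {y ∷ ys} t _ = ascFrom-++ y ys t

ascFrom-[]-< : ∀ {a x} → a < x → ascFrom a [ x ] ≡ 1
ascFrom-[]-< {zero} {suc x} _ = refl
ascFrom-[]-< {suc a} {suc x} (s≤s a<x) = ascFrom-[]-< a<x

ascFrom-[]-≥ : ∀ {a x} → x ≤ a → ascFrom a [ x ] ≡ 0
ascFrom-[]-≥ {zero} {zero} _ = refl
ascFrom-[]-≥ {suc a} {zero} _ = refl
ascFrom-[]-≥ {suc a} {suc x} (s≤s x≤a) = ascFrom-[]-≥ x≤a

asc-snoc-≤ : ∀ {t} x → t ≢ [] → x ≤ lastEntry t → asc (t ++ [ x ]) ≡ asc t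
asc-snoc-≤ {t} x t≢[] x≤last =
  trans (asc-++ [ x ] t≢[]) (trans (cong (asc t +_) (ascFrom-[]-≥ x≤last)) (+-identityʳ (asc t)))

asc-snoc-> : ∀ {t} x → t ≢ [] → lastEntry t < x → asc (t ++ [ x ]) ≡ suc (asc t)
asc-snoc-> {t} x t≢[] last<x =
  trans (asc-++ [ x ] t≢[]) (trans (cong (asc t +_) (ascFrom-[]-< last<x)) (+-comm (asc t) 1))

-- Every entry of an ascent sequence is at most its number of ascents: a new entry
-- x ≤ asc + 1 either creates an ascent or lies below the previous (bounded) entry.
entry≤asc : ∀ {t a} → IsAscentSeq t → a ∈ t → a ≤ asc t
entry≤asc single (here refl) = z≤n
entry≤asc (snoc {ys} x ys-asc ys≢[] x≤) a∈ with x ≤? lastEntry ys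
... | yes x≤last rewrite asc-snoc-≤ x ys≢[] x≤last with ∈-++⁻ ys a∈
...   | inj₁ a∈ys = entry≤asc ys-asc a∈ys
...   | inj₂ (here refl) = ≤-trans x≤last (entry≤asc ys-asc (lastEntry-∈ ys≢[]))
entry≤asc (snoc {ys} x ys-asc ys≢[] x≤) a∈ | no x≰last
  rewrite asc-snoc-> x ys≢[] (≰⇒> x≰last) with ∈-++⁻ ys a∈
...   | inj₁ a∈ys = m≤n⇒m≤1+n (entry≤asc ys-asc a∈ys)
...   | inj₂ (here refl) = ≤-trans x≤ (≤-reflexive (+-comm (asc ys) 1))

last≤asc : ∀ {t} → IsAscentSeq t → t ≢ [] → lastEntry t ≤ asc t
last≤asc t-asc t≢[] = entry≤asc t-asc (lastEntry-∈ t≢[])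

between : ∀ {m x} → m ≤ x → x ≤ m + 1 → x ≡ m ⊎ x ≡ suc m
between {m} m≤x x≤m+1 with m≤n⇒m<n∨m≡n m≤x
... | inj₂ m≡x = inj₁ (sym m≡x)
... | inj₁ m<x = inj₂ (≤-antisym (≤-trans x≤m+1 (≤-reflexive (+-comm m 1))) m<x)

avoids-⊆ : ∀ {s t p} → s ⊆ t → Avoids t p → Avoids s p
avoids-⊆ s⊆t t-avoids (q , q⊆s , iso) = t-avoids (q , ⊆-trans q⊆s s⊆t , iso)

prefix-avoids : ∀ {t x p} → Avoids (t ++ [ x ]) p → Avoids t p
prefix-avoids {p = p} = avoids-⊆ {p = p} (++⁺ʳ _ ⊆-refl)

⊆-snoc⁻ : ∀ q (c : ℕ) {t x} → q ++ [ c ] ⊆ t ++ [ x ] → q ++ [ c ] ⊆ t ⊎ (c ≡ x × q ⊆ t)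
⊆-snoc⁻ [] c {[]} (_ ∷ʳ ())
⊆-snoc⁻ [] c {[]} (c≡x ∷ []) = inj₂ (c≡x , [])
⊆-snoc⁻ (a ∷ []) c {[]} (_ ∷ʳ ())
⊆-snoc⁻ (a ∷ []) c {[]} (_ ∷ ())
⊆-snoc⁻ (a ∷ _ ∷ _) c {[]} (_ ∷ʳ ())
⊆-snoc⁻ (a ∷ _ ∷ _) c {[]} (_ ∷ ())
⊆-snoc⁻ q c {y ∷ t} (_ ∷ʳ σ) =
  Sum.map (y ∷ʳ_) (λ { (c≡x , q⊆t) → c≡x , y ∷ʳ q⊆t }) (⊆-snoc⁻ q c σ)
⊆-snoc⁻ [] c {y ∷ t} (c≡y ∷ _) = inj₁ (c≡y ∷ minimum t)
⊆-snoc⁻ (a ∷ q) c {y ∷ t} (a≡y ∷ σ) =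
  Sum.map (a≡y ∷_) (λ { (c≡x , q⊆t) → c≡x , a≡y ∷ q⊆t }) (⊆-snoc⁻ q c σ)

⊆-++⁻-head : ∀ (v : ℕ) w xs {ys} → v ∷ w ⊆ xs ++ ys → v ∈ xs ⊎ v ∷ w ⊆ ys
⊆-++⁻-head v w [] σ = inj₂ σ
⊆-++⁻-head v w (x ∷ xs) (_ ∷ʳ σ) = Sum.map₁ there (⊆-++⁻-head v w xs σ)
⊆-++⁻-head v w (x ∷ xs) (v≡x ∷ _) = inj₁ (here v≡x)

⊆-++⁻ : ∀ (u v : ℕ) w xs {ys} → u ∷ v ∷ w ⊆ xs ++ ys → u ∷ v ∷ [] ⊆ xs ⊎ v ∷ w ⊆ ys
⊆-++⁻ u v w [] σ = inj₂ (∷ˡ⁻ σ)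
⊆-++⁻ u v w (x ∷ xs) (_ ∷ʳ σ) = Sum.map₁ (x ∷ʳ_) (⊆-++⁻ u v w xs σ)
⊆-++⁻ u v w (x ∷ xs) (u≡x ∷ σ) = Sum.map₁ (λ v∈xs → u≡x ∷ from∈ v∈xs) (⊆-++⁻-head v w xs σ)

before-last : ∀ {t x} → x ∈ t → x ≢ lastEntry t → x ∷ lastEntry t ∷ [] ⊆ t
before-last {a ∷ []} (here refl) x≢a = ⊥-elim (x≢a refl)
before-last {a ∷ y ∷ ys} (here refl) _ = refl ∷ from∈ (lastOr-∈ y ys)
before-last {a ∷ y ∷ ys} (there x∈) x≢last = a ∷ʳ before-last {y ∷ ys} x∈ x≢last

Binary : List ℕ → Set
Binary = All (_≤ 1)

pick : ℕ → ℕ → ℕ → ℕ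
pick a b zero = a
pick a b (suc _) = b

instantiate : ℕ → ℕ → List ℕ → List ℕ
instantiate a b = map (pick a b)

pick-< : ∀ {a b r r'} → a < b → r ≤ 1 → r' ≤ 1 → (pick a b r < pick a b r') ⇔ (r < r')
pick-< a<b z≤n z≤n = mk⇔ (λ a<a → ⊥-elim (<-irrefl refl a<a)) (λ ())
pick-< a<b z≤n (s≤s z≤n) = mk⇔ (λ _ → s≤s z≤n) (λ _ → a<b)
pick-< a<b (s≤s z≤n) z≤n = mk⇔ (λ b<a → ⊥-elim (<-asym a<b b<a)) (λ ())
pick-< a<b (s≤s z≤n) (s≤s z≤n) = mk⇔ (λ b<b → ⊥-elim (<-irrefl refl b<b)) (λ { (s≤s ()) })

pick-≡ : ∀ {a b r r'} → a < b → r ≤ 1 → r' ≤ 1 → (pick a b r ≡ pick a b r') ⇔ (r ≡ r')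
pick-≡ a<b z≤n z≤n = mk⇔ (λ _ → refl) (λ _ → refl)
pick-≡ a<b z≤n (s≤s z≤n) = mk⇔ (λ a≡b → ⊥-elim (<-irrefl a≡b a<b)) (λ ())
pick-≡ a<b (s≤s z≤n) z≤n = mk⇔ (λ b≡a → ⊥-elim (<-irrefl (sym b≡a) a<b)) (λ ())
pick-≡ a<b (s≤s z≤n) (s≤s z≤n) = mk⇔ (λ _ → refl) (λ _ → refl)

lookup-instantiate : ∀ a b p (i : Fin (length (instantiate a b p)))
  .(eq : length (instantiate a b p) ≡ length p) →
  lookup (instantiate a b p) i ≡ pick a b (lookup p (cast eq i))
lookup-instantiate a b (r ∷ p) Fin.zero eq = refl
lookup-instantiate a b (r ∷ p) (Fin.suc i) eq = lookup-instantiate a b p i (suc-injective eq)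

instance-occurs : ∀ {p x a b} → Binary p → a < b → instantiate a b p ⊆ x → Contains x p
instance-occurs {p} {x} {a} {b} bits a<b σ = instantiate a b p , σ , eq , iso
  where
  eq : length (instantiate a b p) ≡ length p
  eq = length-map (pick a b) p
  bit : ∀ i → lookup p i ≤ 1
  bit i = All.lookup bits (∈-lookup i)
  q : List ℕ
  q = instantiate a b p
  iso : ∀ i j → ((lookup q i < lookup q j) ⇔ (lookup p (cast eq i) < lookup p (cast eq j)))
              × ((lookup q i ≡ lookup q j) ⇔ (lookup p (cast eq i) ≡ lookup p (cast eq j)))
  iso i j rewrite lookup-instantiate a b p i eq | lookup-instantiate a b p j eq =
    pick-< a<b (bit _) (bit _) , pick-≡ a<b (bit _) (bit _)

Avoider : List ℕ → ℕ → Pred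
Avoider p n s = IsAscentSeq s × length s ≡ suc n × Avoids s p

length-one : ∀ {s} → IsAscentSeq s → length s ≡ 1 → s ≡ 0 ∷ []
length-one single _ = refl
length-one (snoc {[]} x _ ys≢[] _) _ = ⊥-elim (ys≢[] refl)
length-one (snoc {y ∷ ys} x _ _ _) len with trans (sym (length-snoc ys x)) (suc-injective len)
... | ()

too-short : ∀ {p} → 2 ≤ length p → Avoids (0 ∷ []) p
too-short long (q , q⊆ , len-q≡len-p , _)
  with ≤-trans long (≤-trans (≤-reflexive (sym len-q≡len-p)) (length-mono-≤ q⊆))
... | s≤s ()

avoider-zero : ∀ {p s} → 2 ≤ length p → Avoider p 0 s ⇔ s ≡ 0 ∷ []
avoider-zero {p} long =
  mk⇔ (λ (s-asc , len , _) → length-one s-asc len) (λ { refl → single , refl , too-short {p} long })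

record Growth (p : List ℕ) : Set where
  field
    long           : 2 ≤ length p
    flat rise      : List ℕ → List ℕ
    flat-avoider   : ∀ {n t} → Avoider p n t → Avoider p (suc n) (flat t)
    rise-avoider   : ∀ {n t} → Avoider p n t → Avoider p (suc n) (rise t)
    flat-asc       : ∀ {n t} → Avoider p n t → asc (flat t) ≡ asc t
    rise-asc       : ∀ {n t} → Avoider p n t → asc (rise t) ≡ suc (asc t)
    flat-injective : ∀ {n} → InjectiveOn (Avoider p n) flat
    rise-injective : ∀ {n} → InjectiveOn (Avoider p n) rise
    flat≢rise      : ∀ {n s t} → Avoider p n s → Avoider p n t → flat s ≢ rise t
    cover          : ∀ {n s} → Avoider p (suc n) s → ∃ λ t → Avoider p n t × (s ≡ flat t ⊎ s ≡ rise t)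

-- A growth rule yields the counts 2ⁿ in total and (n choose k) with k ascents: the
-- avoiders of length n + 2 with ascent count in W are the flat images of those of length
-- n + 1 with count in W plus the rise images of those with count in W ∘ suc.
module Counting {p} (G : Growth p) where
  open Growth G

  record Weighted (W : ℕ → Set) (n : ℕ) (s : List ℕ) : Set where
    constructor weigh
    field
      unweigh : Avoider p n s
      weight  : W (asc s)
  open Weighted

  count-start : ∀ {W} → W 0 → HasCard (Weighted W 0) 1
  count-start {W} w = card-single (0 ∷ []) λ s →
    mk⇔ (λ ws → to (avoider-zero {p} long) (unweigh ws))
        (λ { refl → weigh (from (avoider-zero {p} long) refl) w })

  count-start-none : ∀ {W} → ¬ W 0 → HasCard (Weighted W 0) 0
  count-start-none {W} ¬w = card-empty λ s ws →
    ¬w (subst W (cong asc (to (avoider-zero {p} long) (unweigh ws))) (weight ws))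

  Images : (ℕ → Set) → ℕ → Pred
  Images W n s = Image flat (Weighted W n) s ⊎ Image rise (Weighted (λ k → W (suc k)) n) s

  decompose : ∀ W n s → Images W n s ⇔ Weighted W (suc n) s
  decompose W n s = mk⇔ forward backward
    where
    forward : ∀ {s} → Images W n s → Weighted W (suc n) s
    forward (inj₁ (t , wt , refl)) =
      weigh (flat-avoider (unweigh wt)) (subst W (sym (flat-asc (unweigh wt))) (weight wt))
    forward (inj₂ (t , wt , refl)) =
      weigh (rise-avoider (unweigh wt)) (subst W (sym (rise-asc (unweigh wt))) (weight wt))
    backward : ∀ {s} → Weighted W (suc n) s → Images W n s
    backward ws with cover (unweigh ws)
    ... | t , at , inj₁ refl = inj₁ (t , weigh at (subst W (flat-asc at) (weight ws)) , refl)
    ... | t , at , inj₂ refl = inj₂ (t , weigh at (subst W (rise-asc at) (weight ws)) , refl)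

  count-step : ∀ {W n a b} → HasCard (Weighted W n) a → HasCard (Weighted (λ k → W (suc k)) n) b →
    HasCard (Weighted W (suc n)) (a + b)
  count-step {W} {n} flats rises =
    card-resp (decompose W n) (card-union disjoint
      (card-image (λ ws wt → flat-injective (unweigh ws) (unweigh wt)) flats)
      (card-image (λ ws wt → rise-injective (unweigh ws) (unweigh wt)) rises))
    where
    disjoint : ∀ {s t} → Image flat (Weighted W n) s → Image rise (Weighted (λ k → W (suc k)) n) t →
      s ≢ t
    disjoint (_ , ws , refl) (_ , wt , refl) = flat≢rise (unweigh ws) (unweigh wt)

  total : ∀ n → HasCard (Weighted (λ _ → ⊤) n) (2 ^ n)
  total zero = count-start tt
  total (suc n) = subst (HasCard _) (cong (2 ^ n +_) (sym (+-identityʳ (2 ^ n)))) (count-step (total n) (total n))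

  by-ascents : ∀ n k → HasCard (Weighted (_≡ k) n) (n C k)
  by-ascents zero zero = count-start refl
  by-ascents zero (suc k) = count-start-none (λ ())
  by-ascents (suc n) zero = count-step (by-ascents n 0) (card-empty λ _ ws → 0≢1+n (sym (weight ws)))
  by-ascents (suc n) (suc k) =
    subst (HasCard _) (trans (+-comm (n C suc k) (n C k)) (nCk+nC[k+1]≡[n+1]C[k+1] n k))
      (count-step (by-ascents n (suc k)) (card-resp shift (by-ascents n k)))
    where
    shift : ∀ s → Weighted (_≡ k) n s ⇔ Weighted (λ a → suc a ≡ suc k) n s
    shift s = mk⇔ (λ ws → weigh (unweigh ws) (cong suc (weight ws)))
                  (λ ws → weigh (unweigh ws) (suc-injective (weight ws)))

  counts : ∀ n → HasCard (Avoider p n) (2 ^ n) ×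
    (∀ k → HasCard (λ s → IsAscentSeq s × length s ≡ suc n × Avoids s p × asc s ≡ k) (n C k))
  counts n = card-resp (λ s → mk⇔ unweigh (λ as → weigh as tt)) (total n) ,
             λ k → card-resp (λ s → mk⇔ (λ { (weigh (s-asc , len , avoids) w) → s-asc , len , avoids , w })
                                        (λ (s-asc , len , avoids , w) → weigh (s-asc , len , avoids) w))
                             (by-ascents n k)

nonempty : ∀ {s : List ℕ} {n} → length s ≡ suc n → s ≢ []
nonempty len refl = 0≢1+n len

data Grown (σ : List ℕ → ℕ) : List ℕ → Set where
  start : Grown σ (0 ∷ [])
  flat  : ∀ {t} → Grown σ t → Grown σ (t ++ [ σ t ])
  rise  : ∀ {t} → Grown σ t → Grown σ (t ++ [ suc (asc t) ])

grown≢[] : ∀ {σ t} → Grown σ t → t ≢ []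
grown≢[] start ()
grown≢[] (flat {t} _) = snoc≢[] t _
grown≢[] (rise {t} _) = snoc≢[] t _

grown-head : ∀ {σ t} → Grown σ t → ∃ λ ys → t ≡ 0 ∷ ys
grown-head start = [] , refl
grown-head (flat g) with grown-head g
... | ys , refl = ys ++ [ _ ] , refl
grown-head (rise g) with grown-head g
... | ys , refl = ys ++ [ _ ] , refl

module SnocFamily (σ : List ℕ → ℕ) (σ≤last : ∀ {t} → Grown σ t → σ t ≤ lastEntry t) where

  grown-asc : ∀ {t} → Grown σ t → IsAscentSeq t
  grown-asc start = single
  grown-asc (flat {t} g) = snoc (σ t) (grown-asc g) (grown≢[] g)
    (≤-trans (σ≤last g) (≤-trans (last≤asc (grown-asc g) (grown≢[] g)) (m≤m+n (asc t) 1)))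
  grown-asc (rise {t} g) = snoc (suc (asc t)) (grown-asc g) (grown≢[] g) (≤-reflexive (+-comm 1 (asc t)))

  grown-last≤asc : ∀ {t} → Grown σ t → lastEntry t ≤ asc t
  grown-last≤asc g = last≤asc (grown-asc g) (grown≢[] g)

  σ≤asc : ∀ {t} → Grown σ t → σ t ≤ asc t
  σ≤asc g = ≤-trans (σ≤last g) (grown-last≤asc g)

  flat-asc : ∀ {t} → Grown σ t → asc (t ++ [ σ t ]) ≡ asc t
  flat-asc g = asc-snoc-≤ _ (grown≢[] g) (σ≤last g)

  rise-asc : ∀ {t} → Grown σ t → asc (t ++ [ suc (asc t) ]) ≡ suc (asc t)
  rise-asc g = asc-snoc-> _ (grown≢[] g) (s≤s (grown-last≤asc g))

  values-occur : ∀ {t x} → Grown σ t → x ≤ asc t → x ∈ t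
  values-occur start z≤n = here refl
  values-occur (flat g) x≤ = ∈-++⁺ˡ (values-occur g (≤-trans x≤ (≤-reflexive (flat-asc g))))
  values-occur (rise {t} g) x≤ with m≤n⇒m<n∨m≡n (≤-trans x≤ (≤-reflexive (rise-asc g)))
  ... | inj₁ (s≤s x≤asc) = ∈-++⁺ˡ (values-occur g x≤asc)
  ... | inj₂ refl = ∈-++⁺ʳ t (here refl)

  LastLetter : List ℕ → Set
  LastLetter p = ∀ {t x} → Grown σ t → x ≤ asc t + 1 → Avoids (t ++ [ x ]) p → x ≡ σ t ⊎ x ≡ suc (asc t)

  module Rule (p : List ℕ) (long : 2 ≤ length p)
    (last-letter : LastLetter p) (avoids : ∀ {t} → Grown σ t → Avoids t p) where

    characterize : ∀ {s} → IsAscentSeq s → s ≢ [] → Avoids s p → Grown σ s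
    characterize empty s≢[] _ = ⊥-elim (s≢[] refl)
    characterize single _ _ = start
    characterize (snoc x t-asc t≢[] x≤) _ s-avoids with characterize t-asc t≢[] (prefix-avoids {p = p} s-avoids)
    ... | g with last-letter g x≤ s-avoids
    ...   | inj₁ refl = flat g
    ...   | inj₂ refl = rise g

    grown-of : ∀ {n t} → Avoider p n t → Grown σ t
    grown-of (t-asc , len , t-avoids) = characterize t-asc (nonempty len) t-avoids

    avoider-of : ∀ {n t} → Grown σ t → length t ≡ suc n → Avoider p n t
    avoider-of g len = grown-asc g , len , avoids g

    extend-length : ∀ {n t} x → Avoider p n t → length (t ++ [ x ]) ≡ suc (suc n)
    extend-length {t = t} x (_ , len , _) = trans (length-snoc t x) (cong suc len)

    cover : ∀ {n s} → Avoider p (suc n) s →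
      ∃ λ t → Avoider p n t × (s ≡ t ++ [ σ t ] ⊎ s ≡ t ++ [ suc (asc t) ])
    cover {n} s-avoider@(_ , len , _) = go (grown-of s-avoider) len
      where
      go : ∀ {s} → Grown σ s → length s ≡ suc (suc n) →
        ∃ λ t → Avoider p n t × (s ≡ t ++ [ σ t ] ⊎ s ≡ t ++ [ suc (asc t) ])
      go start ()
      go (flat {t} g) len = t , avoider-of g (suc-injective (trans (sym (length-snoc t _)) len)) , inj₁ refl
      go (rise {t} g) len = t , avoider-of g (suc-injective (trans (sym (length-snoc t _)) len)) , inj₂ refl

    growth : Growth p
    growth = record
      { long = long
      ; flat = λ t → t ++ [ σ t ]
      ; rise = λ t → t ++ [ suc (asc t) ]
      ; flat-avoider = λ a → avoider-of (flat (grown-of a)) (extend-length _ a)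
      ; rise-avoider = λ a → avoider-of (rise (grown-of a)) (extend-length _ a)
      ; flat-asc = λ a → flat-asc (grown-of a)
      ; rise-asc = λ a → rise-asc (grown-of a)
      ; flat-injective = λ {_} {s} {t} _ _ e → proj₁ (∷ʳ-injective s t e)
      ; rise-injective = λ {_} {s} {t} _ _ e → proj₁ (∷ʳ-injective s t e)
      ; flat≢rise = flat≢rise
      ; cover = cover
      }
      where
      flat≢rise : ∀ {n s t} → Avoider p n s → Avoider p n t → s ++ [ σ s ] ≢ t ++ [ suc (asc t) ]
      flat≢rise {s = s} {t} as _ e with ∷ʳ-injective s t e
      ... | refl , σs≡ = <-irrefl σs≡ (s≤s (σ≤asc (grown-of as)))

pat-10 pat-001 pat-010 pat-011 : List ℕ
pat-10 = 1 ∷ 0 ∷ []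
pat-001 = 0 ∷ 0 ∷ 1 ∷ []
pat-010 = 0 ∷ 1 ∷ 0 ∷ []
pat-011 = 0 ∷ 1 ∷ 1 ∷ []

bits-10 : Binary pat-10
bits-10 = s≤s z≤n ∷ z≤n ∷ []

bits-010 : Binary pat-010
bits-010 = z≤n ∷ s≤s z≤n ∷ z≤n ∷ []

bits-011 : Binary pat-011
bits-011 = z≤n ∷ s≤s z≤n ∷ s≤s z≤n ∷ []

bits-001 : Binary pat-001
bits-001 = z≤n ∷ z≤n ∷ s≤s z≤n ∷ []

occurrence-10 : ∀ {x} → Contains x pat-10 → ∃₂ λ a b → a < b × b ∷ a ∷ [] ⊆ x
occurrence-10 (c ∷ d ∷ [] , σ , _ , iso) = d , c , from (proj₁ (iso (Fin.suc Fin.zero) Fin.zero)) (s≤s z≤n) , σ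

occurrence-010 : ∀ {x} → Contains x pat-010 → ∃₂ λ a b → a < b × a ∷ b ∷ a ∷ [] ⊆ x
occurrence-010 (c ∷ d ∷ e ∷ [] , σ , _ , iso) with from (proj₂ (iso Fin.zero (Fin.suc (Fin.suc Fin.zero)))) refl
... | refl = c , d , from (proj₁ (iso Fin.zero (Fin.suc Fin.zero))) (s≤s z≤n) , σ

occurrence-011 : ∀ {x} → Contains x pat-011 → ∃₂ λ a b → a < b × a ∷ b ∷ b ∷ [] ⊆ x
occurrence-011 (c ∷ d ∷ e ∷ [] , σ , _ , iso)
  with from (proj₂ (iso (Fin.suc Fin.zero) (Fin.suc (Fin.suc Fin.zero)))) refl
... | refl = c , d , from (proj₁ (iso Fin.zero (Fin.suc Fin.zero))) (s≤s z≤n) , σ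

occurrence-001 : ∀ {x} → Contains x pat-001 → ∃₂ λ a b → a < b × a ∷ a ∷ b ∷ [] ⊆ x
occurrence-001 (c ∷ d ∷ e ∷ [] , σ , _ , iso) with from (proj₂ (iso Fin.zero (Fin.suc Fin.zero))) refl
... | refl = c , e , from (proj₁ (iso Fin.zero (Fin.suc (Fin.suc Fin.zero)))) (s≤s z≤n) , σ

-- Every occurrence of 010 contains one of 10.
avoids-010-of-10 : ∀ {x} → Avoids x pat-10 → Avoids x pat-010
avoids-010-of-10 x-avoids occ with occurrence-010 occ
... | a , b , a<b , σ = x-avoids (instance-occurs bits-10 a<b (∷ˡ⁻ σ))

avoids-10-snoc : ∀ {t x} → Avoids t pat-10 → (∀ {b} → b ∈ t → b ≤ x) → Avoids (t ++ [ x ]) pat-10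
avoids-10-snoc t-avoids bounded occ with occurrence-10 occ
... | a , b , a<b , σ with ⊆-snoc⁻ (b ∷ []) a σ
...   | inj₁ σ' = t-avoids (instance-occurs bits-10 a<b σ')
...   | inj₂ (refl , b⊆t) = <-irrefl refl (<-≤-trans a<b (bounded (to∈ b⊆t)))

-- Patterns 10 and 010: the flat step repeats the number of ascents, which is always the
-- last entry; the avoiders are the sequences whose entries grow by steps of 0 or 1.
last≡asc : ∀ {t} → Grown asc t → lastEntry t ≡ asc t
last≡asc start = refl
last≡asc (flat {t} g) =
  trans (lastEntry-snoc t (asc t)) (sym (asc-snoc-≤ (asc t) (grown≢[] g) (≤-reflexive (sym (last≡asc g)))))
last≡asc (rise {t} g) =
  trans (lastEntry-snoc t _) (sym (asc-snoc-> _ (grown≢[] g) (s≤s (≤-reflexive (last≡asc g)))))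

module UnitSteps = SnocFamily asc (λ g → ≤-reflexive (sym (last≡asc g)))

-- Unit-step sequences are weakly increasing, so they avoid 10.
unit-steps-avoid-10 : ∀ {t} → Grown asc t → Avoids t pat-10
unit-steps-avoid-10 start = too-short ≤-refl
unit-steps-avoid-10 (flat g) = avoids-10-snoc (unit-steps-avoid-10 g) (entry≤asc (UnitSteps.grown-asc g))
unit-steps-avoid-10 (rise g) =
  avoids-10-snoc (unit-steps-avoid-10 g) (λ b∈ → m≤n⇒m≤1+n (entry≤asc (UnitSteps.grown-asc g) b∈))

-- After t, a letter x < asc t = lastEntry t completes the occurrence (lastEntry t) x of 10.
last-letter-10 : UnitSteps.LastLetter pat-10
last-letter-10 {t} {x} g x≤ s-avoids with x <? asc t
... | no x≮asc = between (≮⇒≥ x≮asc) x≤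
... | yes x<asc =
  ⊥-elim (s-avoids (instance-occurs bits-10 x<last (++⁺ (from∈ (lastEntry-∈ (grown≢[] g))) (refl ∷ []))))
  where
  x<last : x < lastEntry t
  x<last = <-≤-trans x<asc (≤-reflexive (sym (last≡asc g)))

-- After t, a letter x < asc t already occurs before the last entry asc t, completing the
-- occurrence x (asc t) x of 010.
last-letter-010 : UnitSteps.LastLetter pat-010
last-letter-010 {t} {x} g x≤ s-avoids with x <? asc t
... | no x≮asc = between (≮⇒≥ x≮asc) x≤
... | yes x<asc =
  ⊥-elim (s-avoids (instance-occurs bits-010 x<last (++⁺ (before-last x∈t (<⇒≢ x<last)) (refl ∷ []))))
  where
  x<last : x < lastEntry t
  x<last = <-≤-trans x<asc (≤-reflexive (sym (last≡asc g)))
  x∈t : x ∈ t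
  x∈t = UnitSteps.values-occur g (<⇒≤ x<asc)

growth-10 : Growth pat-10
growth-10 = UnitSteps.Rule.growth pat-10 ≤-refl last-letter-10 unit-steps-avoid-10

growth-010 : Growth pat-010
growth-010 = UnitSteps.Rule.growth pat-010 (s≤s (s≤s z≤n)) last-letter-010
  (λ g → avoids-010-of-10 (unit-steps-avoid-10 g))

-- Pattern 011: the flat step appends 0; the avoiders are the sequences in which every
-- entry is 0 or a new maximum.
module ZeroOrNew = SnocFamily (λ _ → 0) (λ _ → z≤n)

-- An occurrence a b b of 011 cannot end in a new letter: not 0 (nothing lies below it)
-- and not a new maximum (which does not occur earlier).
zero-or-new-avoid-011 : ∀ {t} → Grown (λ _ → 0) t → Avoids t pat-011
zero-or-new-avoid-011 start = too-short (s≤s (s≤s z≤n))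
zero-or-new-avoid-011 (flat g) occ with occurrence-011 occ
... | a , b , a<b , σ with ⊆-snoc⁻ (a ∷ b ∷ []) b σ
...   | inj₁ σ' = zero-or-new-avoid-011 g (instance-occurs bits-011 a<b σ')
...   | inj₂ (refl , _) with a<b
...     | ()
zero-or-new-avoid-011 (rise g) occ with occurrence-011 occ
... | a , b , a<b , σ with ⊆-snoc⁻ (a ∷ b ∷ []) b σ
...   | inj₁ σ' = zero-or-new-avoid-011 g (instance-occurs bits-011 a<b σ')
...   | inj₂ (refl , ab⊆t) = <-irrefl refl (s≤s (entry≤asc (ZeroOrNew.grown-asc g) (to∈ (∷ˡ⁻ ab⊆t))))

-- A positive entry x ≤ asc t already occurs after the initial 0, so appending it completes a 011.
last-letter-011 : ZeroOrNew.LastLetter pat-011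
last-letter-011 g x≤ s-avoids with grown-head g
last-letter-011 {x = zero} g x≤ s-avoids | _ = inj₁ refl
last-letter-011 {t} {suc y} g x≤ s-avoids | ys , refl with suc y ≤? asc t
... | no x≰asc = inj₂ (≤-antisym (≤-trans x≤ (≤-reflexive (+-comm (asc t) 1))) (≰⇒> x≰asc))
... | yes x≤asc with ZeroOrNew.values-occur g x≤asc
...   | there x∈ys =
  ⊥-elim (s-avoids (instance-occurs bits-011 (s≤s z≤n) (++⁺ (refl ∷ from∈ x∈ys) (refl ∷ []))))

growth-011 : Growth pat-011
growth-011 = ZeroOrNew.Rule.growth pat-011 (s≤s (s≤s z≤n)) last-letter-011 zero-or-new-avoid-011

-- Pattern 001: the avoiders are the staircases 0 1 … k followed by a weakly decreasing
-- sequence of entries ≤ k.  Flat inserts a copy of k after the staircase, rise extends it.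
stair : ℕ → List ℕ
stair zero = 0 ∷ []
stair (suc k) = stair k ++ [ suc k ]

data Descending : ℕ → List ℕ → Set where
  []  : ∀ {k} → Descending k []
  _∷_ : ∀ {k y t} → y ≤ k → Descending y t → Descending k (y ∷ t)

stair≢[] : ∀ k → stair k ≢ []
stair≢[] zero ()
stair≢[] (suc k) = snoc≢[] (stair k) (suc k)

last-stair : ∀ k → lastEntry (stair k) ≡ k
last-stair zero = refl
last-stair (suc k) = lastEntry-snoc (stair k) (suc k)

asc-stair : ∀ k → asc (stair k) ≡ k
asc-stair zero = refl
asc-stair (suc k) =
  trans (asc-snoc-> (suc k) (stair≢[] k) (s≤s (≤-reflexive (last-stair k)))) (cong suc (asc-stair k))

length-stair : ∀ k → length (stair k) ≡ suc k
length-stair zero = refl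
length-stair (suc k) = trans (length-snoc (stair k) (suc k)) (cong suc (length-stair k))

stair-asc : ∀ k → IsAscentSeq (stair k)
stair-asc zero = single
stair-asc (suc k) =
  snoc (suc k) (stair-asc k) (stair≢[] k) (≤-reflexive (trans (+-comm 1 k) (cong (_+ 1) (sym (asc-stair k)))))

stair-entries : ∀ {k a} → a ∈ stair k → a ≤ k
stair-entries {zero} (here refl) = z≤n
stair-entries {suc k} a∈ with ∈-++⁻ (stair k) a∈
... | inj₁ a∈stair = m≤n⇒m≤1+n (stair-entries a∈stair)
... | inj₂ (here refl) = ≤-refl

stair-values : ∀ {k a} → a ≤ k → a ∈ stair k
stair-values {zero} z≤n = here refl
stair-values {suc k} a≤ with m≤n⇒m<n∨m≡n a≤
... | inj₁ (s≤s a≤k) = ∈-++⁺ˡ (stair-values a≤k)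
... | inj₂ refl = ∈-++⁺ʳ (stair k) (here refl)

stair-no-repeat : ∀ k {a} → ¬ (a ∷ a ∷ [] ⊆ stair k)
stair-no-repeat zero (_ ∷ʳ ())
stair-no-repeat zero (_ ∷ ())
stair-no-repeat (suc k) {a} σ with ⊆-snoc⁻ (a ∷ []) a σ
... | inj₁ σ' = stair-no-repeat k σ'
... | inj₂ (refl , a⊆stair) = <-irrefl refl (s≤s (stair-entries (to∈ a⊆stair)))

desc-head : ∀ {k y t} → Descending k (y ∷ t) → y ≤ k
desc-head (y≤k ∷ _) = y≤k

desc-entries : ∀ {k t b} → Descending k t → b ∈ t → b ≤ k
desc-entries (y≤k ∷ d) (here refl) = y≤k
desc-entries (y≤k ∷ d) (there b∈) = ≤-trans (desc-entries d b∈) y≤k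

desc-no-ascent : ∀ {k t a b} → Descending k t → a < b → ¬ (a ∷ b ∷ [] ⊆ t)
desc-no-ascent (_ ∷ d) a<b (_ ∷ʳ σ) = desc-no-ascent d a<b σ
desc-no-ascent (_ ∷ d) a<b (refl ∷ σ) = <-irrefl refl (<-≤-trans a<b (desc-entries d (to∈ σ)))

desc-snoc : ∀ {k t x} → Descending k t → x ≤ lastOr k t → Descending k (t ++ [ x ])
desc-snoc [] x≤k = x≤k ∷ []
desc-snoc (y≤k ∷ d) x≤last = y≤k ∷ desc-snoc d x≤last

desc-weaken : ∀ {k k' t} → Descending k t → k ≤ k' → Descending k' t
desc-weaken [] _ = []
desc-weaken (y≤k ∷ d) k≤k' = ≤-trans y≤k k≤k' ∷ d

ascFrom-desc : ∀ {k t} → Descending k t → ascFrom k t ≡ 0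
ascFrom-desc [] = refl
ascFrom-desc {k} {y ∷ t} (y≤k ∷ d) =
  trans (ascFrom-++ k [ y ] t) (cong₂ _+_ (ascFrom-[]-≥ y≤k) (ascFrom-desc d))

ascSeq-++-desc : ∀ {s t} → IsAscentSeq s → s ≢ [] → Descending (lastEntry s) t → IsAscentSeq (s ++ t)
ascSeq-++-desc {s} s-asc s≢[] [] = subst IsAscentSeq (sym (++-identityʳ s)) s-asc
ascSeq-++-desc {s} {y ∷ t} s-asc s≢[] (y≤last ∷ d) =
  subst IsAscentSeq (++-assoc s [ y ] t)
    (ascSeq-++-desc (snoc y s-asc s≢[] (≤-trans y≤last (≤-trans (last≤asc s-asc s≢[]) (m≤m+n (asc s) 1))))
                    (snoc≢[] s y) (subst (λ a → Descending a t) (sym (lastEntry-snoc s y)) d))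

Staircase : List ℕ → Set
Staircase s = ∃₂ λ k t → s ≡ stair k ++ t × Descending k t

asc-staircase : ∀ {k t} → Descending k t → asc (stair k ++ t) ≡ k
asc-staircase {k} {t} d = begin
  asc (stair k ++ t)                              ≡⟨ asc-++ t (stair≢[] k) ⟩
  asc (stair k) + ascFrom (lastEntry (stair k)) t ≡⟨ cong₂ (λ a b → a + ascFrom b t) (asc-stair k) (last-stair k) ⟩
  k + ascFrom k t                                 ≡⟨ cong (k +_) (ascFrom-desc d) ⟩
  k + 0                                           ≡⟨ +-identityʳ k ⟩
  k                                               ∎
  where open ≡-Reasoning

length-staircase : ∀ k t → length (stair k ++ t) ≡ suc (k + length t)
length-staircase k t = trans (length-++ (stair k)) (cong (_+ length t) (length-stair k))

-- A staircase shape avoids 001: a repeated letter a cannot lie in the staircase, so the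
-- second a and the larger b would form an ascent in the descending part.
staircase-avoids : ∀ {k t} → Descending k t → Avoids (stair k ++ t) pat-001
staircase-avoids {k} d occ with occurrence-001 occ
... | a , b , a<b , σ with ⊆-++⁻ a a (b ∷ []) (stair k) σ
...   | inj₁ aa⊆stair = stair-no-repeat k aa⊆stair
...   | inj₂ ab⊆t = desc-no-ascent d a<b ab⊆t

staircase-avoider : ∀ {k t n} → Descending k t → k + length t ≡ n → Avoider pat-001 n (stair k ++ t)
staircase-avoider {k} {t} d refl =
  ascSeq-++-desc (stair-asc k) (stair≢[] k) (subst (λ a → Descending a t) (sym (last-stair k)) d) ,
  length-staircase k t , staircase-avoids d

-- Appending x ≤ k + 1 to a staircase shape keeps the shape, unless x exceeds the last entry
-- ℓ of a nonempty descending part: then ℓ (also in the staircase), ℓ, x is a 001.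
staircase-snoc : ∀ {k t x} → Descending k t → x ≤ k + 1 →
  Avoids ((stair k ++ t) ++ [ x ]) pat-001 → Staircase ((stair k ++ t) ++ [ x ])
staircase-snoc {k} {t} {x} d x≤ s-avoids with x ≤? lastOr k t
... | yes x≤last = k , t ++ [ x ] , ++-assoc (stair k) t [ x ] , desc-snoc d x≤last
staircase-snoc {k} {[]} {x} [] x≤ s-avoids | no x≰k
  with ≤-antisym (≤-trans x≤ (≤-reflexive (+-comm k 1))) (≰⇒> x≰k)
... | refl =
  suc k , [] , trans (cong (_++ [ suc k ]) (++-identityʳ (stair k))) (sym (++-identityʳ (stair (suc k)))) , []
staircase-snoc {k} {y ∷ t} {x} d x≤ s-avoids | no x≰last =
  ⊥-elim (s-avoids (instance-occurs bits-001 (≰⇒> x≰last)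
    (subst (_ ⊆_) (sym (++-assoc (stair k) (y ∷ t) [ x ])) occurrence)))
  where
  ℓ∈t : lastOr y t ∈ y ∷ t
  ℓ∈t = lastOr-∈ y t
  occurrence : lastOr y t ∷ lastOr y t ∷ x ∷ [] ⊆ stair k ++ ((y ∷ t) ++ [ x ])
  occurrence = ++⁺ (from∈ (stair-values (desc-entries d ℓ∈t))) (++⁺ (from∈ ℓ∈t) (refl ∷ []))

staircase-of : ∀ {s} → IsAscentSeq s → s ≢ [] → Avoids s pat-001 → Staircase s
staircase-of empty s≢[] _ = ⊥-elim (s≢[] refl)
staircase-of single _ _ = 0 , [] , refl , []
staircase-of (snoc x s-asc s≢[] x≤) _ s-avoids
  with staircase-of s-asc s≢[] (prefix-avoids {p = pat-001} s-avoids)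
... | k , t , refl , d = staircase-snoc d (subst (λ a → x ≤ a + 1) (asc-staircase d) x≤) s-avoids

-- The staircase shape is read off from a sequence: k is its number of ascents and the
-- descending part is what follows the first k + 1 entries.
tail-of : List ℕ → List ℕ
tail-of s = drop (suc (asc s)) s

drop-++ : ∀ (xs ys : List ℕ) → drop (length xs) (xs ++ ys) ≡ ys
drop-++ [] ys = refl
drop-++ (x ∷ xs) ys = drop-++ xs ys

tail-staircase : ∀ {k t} → Descending k t → tail-of (stair k ++ t) ≡ t
tail-staircase {k} {t} d rewrite asc-staircase d | sym (length-stair k) = drop-++ (stair k) t

normal-form : ∀ {n s} → Avoider pat-001 n s →
  s ≡ stair (asc s) ++ tail-of s × Descending (asc s) (tail-of s)
normal-form (s-asc , len , s-avoids) with staircase-of s-asc (nonempty len) s-avoids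
... | k , t , refl , d rewrite tail-staircase d | asc-staircase d = refl , d

-- The staircase shape of a sequence is unique (k is its number of ascents).
staircase-injective : ∀ {k k' t t'} → Descending k t → Descending k' t' →
  stair k ++ t ≡ stair k' ++ t' → k ≡ k' × t ≡ t'
staircase-injective {k} {t = t} {t'} d d' e
  with trans (sym (asc-staircase d)) (trans (cong asc e) (asc-staircase d'))
... | refl = refl , ++-cancelˡ (stair k) t t' e

flat-001 rise-001 : List ℕ → List ℕ
flat-001 s = stair (asc s) ++ (asc s ∷ tail-of s)
rise-001 s = stair (suc (asc s)) ++ tail-of s

flat-staircase : ∀ {k t} → Descending k t → flat-001 (stair k ++ t) ≡ stair k ++ (k ∷ t)
flat-staircase d rewrite tail-staircase d | asc-staircase d = refl

rise-staircase : ∀ {k t} → Descending k t → rise-001 (stair k ++ t) ≡ stair (suc k) ++ t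
rise-staircase d rewrite tail-staircase d | asc-staircase d = refl

module _ {n s} (a : Avoider pat-001 n s) where
  tail-descending : Descending (asc s) (tail-of s)
  tail-descending = proj₂ (normal-form a)

  normal-size : asc s + length (tail-of s) ≡ n
  normal-size = suc-injective (trans (sym (length-staircase (asc s) (tail-of s)))
                                     (trans (cong length (sym (proj₁ (normal-form a)))) (proj₁ (proj₂ a))))

normal-injective : ∀ {n s s'} → Avoider pat-001 n s → Avoider pat-001 n s' →
  asc s ≡ asc s' → tail-of s ≡ tail-of s' → s ≡ s'
normal-injective a a' k≡k' t≡t' =
  trans (proj₁ (normal-form a)) (trans (cong₂ (λ k t → stair k ++ t) k≡k' t≡t') (sym (proj₁ (normal-form a'))))

-- A staircase shape of length n + 2 arises by flat or rise from an avoider of length n + 1: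
-- by flat if its descending part starts with k, by rise otherwise.
cover-staircase : ∀ {n k t} → Descending k t → k + length t ≡ suc n →
  ∃ λ u → Avoider pat-001 n u × (stair k ++ t ≡ flat-001 u ⊎ stair k ++ t ≡ rise-001 u)
cover-staircase {k = zero} [] ()
cover-staircase {k = suc k} [] len =
  stair k ++ [] , staircase-avoider [] (suc-injective len) , inj₂ (sym (rise-staircase []))
cover-staircase {k = k} {y ∷ t} (y≤k ∷ d) len with m≤n⇒m<n∨m≡n y≤k
... | inj₂ refl =
  stair k ++ t , staircase-avoider d (suc-injective (trans (sym (+-suc k (length t))) len)) ,
  inj₁ (sym (flat-staircase d))
cover-staircase {k = suc k} {y ∷ t} (_ ∷ d) len | inj₁ (s≤s y≤k) =
  stair k ++ (y ∷ t) , staircase-avoider (y≤k ∷ d) (suc-injective len) ,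
  inj₂ (sym (rise-staircase (y≤k ∷ d)))

growth-001 : Growth pat-001
growth-001 = record
  { long = s≤s (s≤s z≤n)
  ; flat = flat-001
  ; rise = rise-001
  ; flat-avoider = λ a →
      staircase-avoider (≤-refl ∷ tail-descending a) (trans (+-suc _ _) (cong suc (normal-size a)))
  ; rise-avoider = λ a → staircase-avoider (desc-weaken (tail-descending a) (n≤1+n _)) (cong suc (normal-size a))
  ; flat-asc = λ a → asc-staircase (≤-refl ∷ tail-descending a)
  ; rise-asc = λ a → asc-staircase (desc-weaken (tail-descending a) (n≤1+n _))
  ; flat-injective = flat-injective
  ; rise-injective = rise-injective
  ; flat≢rise = flat≢rise
  ; cover = cover
  }
  where
  flat-injective : ∀ {n} → InjectiveOn (Avoider pat-001 n) flat-001
  flat-injective a a' e with staircase-injective (≤-refl ∷ tail-descending a) (≤-refl ∷ tail-descending a') e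
  ... | k≡k' , kt≡k't' = normal-injective a a' k≡k' (∷-injectiveʳ kt≡k't')

  rise-injective : ∀ {n} → InjectiveOn (Avoider pat-001 n) rise-001
  rise-injective a a' e
    with staircase-injective (desc-weaken (tail-descending a) (n≤1+n _))
                             (desc-weaken (tail-descending a') (n≤1+n _)) e
  ... | k+1≡k'+1 , t≡t' = normal-injective a a' (suc-injective k+1≡k'+1) t≡t'

  -- flat s = rise s' would force asc s = asc s' + 1 to head a descending part bounded by asc s'
  flat≢rise : ∀ {n s s'} → Avoider pat-001 n s → Avoider pat-001 n s' → flat-001 s ≢ rise-001 s'
  flat≢rise {s' = s'} a a' e
    with staircase-injective (≤-refl ∷ tail-descending a) (desc-weaken (tail-descending a') (n≤1+n _)) e
  ... | k≡k'+1 , kt≡t' =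
    <-irrefl refl (subst (_≤ asc s') k≡k'+1
      (desc-head (subst (Descending (asc s')) (sym kt≡t') (tail-descending a'))))

  cover : ∀ {n s} → Avoider pat-001 (suc n) s →
    ∃ λ u → Avoider pat-001 n u × (s ≡ flat-001 u ⊎ s ≡ rise-001 u)
  cover {n} a = subst (λ v → ∃ λ u → Avoider pat-001 n u × (v ≡ flat-001 u ⊎ v ≡ rise-001 u))
                      (sym (proj₁ (normal-form a))) (cover-staircase (tail-descending a) (normal-size a))

theorem2p1 : (p : List ℕ) →
    (p ≡ 1 ∷ 0 ∷ [] ⊎ p ≡ 0 ∷ 0 ∷ 1 ∷ [] ⊎ p ≡ 0 ∷ 1 ∷ 0 ∷ [] ⊎ p ≡ 0 ∷ 1 ∷ 1 ∷ []) →
    (n : ℕ) →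
      HasCard (λ x → IsAscentSeq x × length x ≡ suc n × Avoids x p) (2 ^ n)
      × (∀ (k : ℕ) → HasCard (λ x → IsAscentSeq x × length x ≡ suc n × Avoids x p × asc x ≡ k) (n C k))
theorem2p1 p (inj₁ refl) = Counting.counts growth-10
theorem2p1 p (inj₂ (inj₁ refl)) = Counting.counts growth-001
theorem2p1 p (inj₂ (inj₂ (inj₁ refl))) = Counting.counts growth-010
theorem2p1 p (inj₂ (inj₂ (inj₂ refl))) = Counting.counts growth-011
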